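{- For every integer $1\leq k\leq 5$, the $k$-tuple domination number of the Kneser graph $K(7,3)$ equals $7k$.
   Context: The Kneser graph $K(n,r)$ has as vertices the $r$-subsets of $[n]=\{1,\dots,n\}$, two vertices adjacent iff disjoint. For a vertex $v$, $N[v]$ is its closed neighbourhood. A set $D$ of vertices is a $k$-tuple dominating set if $|N[v]\cap D|\geq k$ for every vertex $v$; the $k$-tuple domination number is the minimum cardinality of such a set. -}

module Defs where

open import Data.Nat using (ℕ; _≥_)
open import Data.Bool using (Bool; true; false)
open import Data.Fin using (Fin)
open import Data.Fin.Subset using (Subset; ∣_∣; _∩_; ⊥)
open import Data.Product using (Σ; _,_; proj₁; _×_)
open import Data.List using (List; length; filter; map)
open import Data.List.Relation.Unary.Unique.Propositional using (Unique)
open import Data.Vec.Properties using (≡-dec)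
open import Data.Bool.Properties using () renaming (_≟_ to _≟B_)
open import Relation.Binary.PropositionalEquality using (_≡_)
open import Relation.Nullary using (Dec)
open import Data.Sum using (_⊎_)
open import Relation.Nullary.Decidable using (_⊎-dec_)

Vertex : ℕ → ℕ → Set
Vertex n r = Σ (Subset n) (λ s → ∣ s ∣ ≡ r)

_≟S_ : ∀ {n} → (s t : Subset n) → Dec (s ≡ t)
_≟S_ = ≡-dec _≟B_

InClosedNbhd : ∀ {n r} → Vertex n r → Vertex n r → Set
InClosedNbhd (u , _) (v , _) = (u ≡ v) ⊎ (u ∩ v ≡ ⊥)

inClosedNbhd? : ∀ {n r} (u v : Vertex n r) → Dec (InClosedNbhd u v)
inClosedNbhd? (u , _) (v , _) = (u ≟S v) ⊎-dec ((u ∩ v) ≟S ⊥)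

IsVertexSet : ∀ {n r} → List (Vertex n r) → Set
IsVertexSet D = Unique (map proj₁ D)

nbhdCount : ∀ {n r} → List (Vertex n r) → Vertex n r → ℕ
nbhdCount D v = length (filter (λ u → inClosedNbhd? u v) D)

IsKTupleDominating : ∀ {n r} → ℕ → List (Vertex n r) → Set
IsKTupleDominating k D = IsVertexSet D × (∀ v → nbhdCount D v ≥ k)

KTupleDominationNumberIs : ℕ → ℕ → ℕ → ℕ → Set
KTupleDominationNumberIs n r k m =
  Σ (List (Vertex n r)) (λ D → IsKTupleDominating k D × length D ≡ m)
  × (∀ (D : List (Vertex n r)) → IsKTupleDominating k D → length D ≥ m)

{-# OPTIONS --safe #-}
-- Every closed neighbourhood of K(7,3) has 1 + C(4,3) = 5 vertices, so counting the
-- pairs (v , u) with u ∈ N[v] ∩ D in two ways gives 35 k ≤ 5 |D| for a k-tuple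
-- dominating set D. Conversely, the lines of the Fano plane (the translates of the
-- difference set {0,1,3} mod 7) meet every closed neighbourhood exactly once, and
-- together with the lines of the second Fano plane (translates of {0,2,3}) exactly
-- twice; their complements in the 35 vertices therefore meet it 4 resp. 3 times, and
-- all 35 vertices 5 times. These sets have sizes 7, 14, 21, 28, 35, and all the
-- neighbourhood counts are checked by exhausting the subsets of [7].
module Submission where

open import Defs
open import Algebra.Properties.CommutativeSemigroup using (interchange)
open import Data.Fin.Subset using (Subset; inside; outside; ∣_∣; _∪_; ⁅_⁆; ⊥)
open import Data.Fin.Subset.Properties using (∩-comm; anySubset?)
open import Data.List using (List; []; _∷_; [_]; _++_; length; filter; map; mapMaybe; foldr; upTo)
open import Data.List.Properties using (filter-≐; map-cong)
open import Data.List.Relation.Unary.Unique.DecPropositional using (unique?)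
import Data.Vec as Vec
open import Data.Maybe using (Maybe; just; nothing)
open import Data.Nat using (ℕ; zero; suc; _≤_; _≥_; _*_; _+_; _≟_; _≤?_; z≤n; s≤s; NonZero)
open import Data.Nat.DivMod using (_mod_)
open import Data.Nat.ListAction using (sum)
open import Data.Nat.Properties
  using (+-mono-≤; *-comm; *-assoc; *-zeroʳ; *-cancelˡ-≤; ≤-reflexive; ≡-irrelevant; +-commutativeSemigroup; module ≤-Reasoning)
open import Data.Product using (Σ; _,_; proj₁; _×_)
open import Data.Sum using (inj₁; inj₂)
open import Function using (_∘_)
open import Relation.Binary.Core using (REL)
import Relation.Binary.Definitions as B
open import Relation.Binary.PropositionalEquality using (_≡_; refl; sym; trans; cong; cong₂; subst; module ≡-Reasoning)
open import Relation.Nullary using (Dec; yes; no; ¬?; contradiction)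
open import Relation.Nullary.Decidable using (map′; decidable-stable; from-yes; _×-dec_)
open import Relation.Unary as U using (Pred)

indicator : ∀ {p} {P : Set p} → Dec P → ℕ
indicator (yes _) = 1
indicator (no _)  = 0

module _ {a p} {A : Set a} {P : Pred A p} (P? : U.Decidable P) where

  length-filter-∷ : ∀ x xs → length (filter P? (x ∷ xs)) ≡ indicator (P? x) + length (filter P? xs)
  length-filter-∷ x xs with P? x
  ... | yes _ = refl
  ... | no  _ = refl

  sum-indicator : ∀ xs → sum (map (indicator ∘ P?) xs) ≡ length (filter P? xs)
  sum-indicator []       = refl
  sum-indicator (x ∷ xs) = trans (cong (indicator (P? x) +_) (sum-indicator xs)) (sym (length-filter-∷ x xs))

module _ {a} {A : Set a} where

  sum-map-+ : ∀ (f g : A → ℕ) xs → sum (map (λ x → f x + g x) xs) ≡ sum (map f xs) + sum (map g xs)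
  sum-map-+ f g []       = refl
  sum-map-+ f g (x ∷ xs) =
    trans (cong (f x + g x +_) (sum-map-+ f g xs)) (interchange +-commutativeSemigroup (f x) (g x) _ _)

  sum-map-const : ∀ c (xs : List A) → sum (map (λ _ → c) xs) ≡ length xs * c
  sum-map-const c []       = refl
  sum-map-const c (x ∷ xs) = cong (c +_) (sum-map-const c xs)

  sum-map-mono : ∀ {f g : A → ℕ} → (∀ x → f x ≤ g x) → ∀ xs → sum (map f xs) ≤ sum (map g xs)
  sum-map-mono f≤g []       = z≤n
  sum-map-mono f≤g (x ∷ xs) = +-mono-≤ (f≤g x) (sum-map-mono f≤g xs)

module _ {a b r} {A : Set a} {B : Set b} {R : REL A B r} (R? : B.Decidable R) where

  sum-count-swap : ∀ (xs : List A) (ys : List B) →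
    sum (map (λ y → length (filter (λ x → R? x y) xs)) ys) ≡ sum (map (λ x → length (filter (R? x) ys)) xs)
  sum-count-swap xs []       = sym (trans (sum-map-const 0 xs) (*-zeroʳ (length xs)))
  sum-count-swap xs (y ∷ ys) = begin
      length (filter (λ x → R? x y) xs) + sum (map (λ y → length (filter (λ x → R? x y) xs)) ys)
    ≡⟨ cong₂ _+_ (sym (sum-indicator (λ x → R? x y) xs)) (sum-count-swap xs ys) ⟩
      sum (map (λ x → indicator (R? x y)) xs) + sum (map (λ x → length (filter (R? x) ys)) xs)
    ≡⟨ sym (sum-map-+ _ _ xs) ⟩
      sum (map (λ x → indicator (R? x y) + length (filter (R? x) ys)) xs)
    ≡⟨ cong sum (map-cong (λ x → sym (length-filter-∷ (R? x) y ys)) xs) ⟩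
      sum (map (λ x → length (filter (R? x) (y ∷ ys))) xs)
    ∎
    where open ≡-Reasoning

module _ {n ℓ} {P : Pred (Subset n) ℓ} (P? : U.Decidable P) where

  allSubsets? : Dec (∀ s → P s)
  allSubsets? = map′ (λ ∄¬P s → decidable-stable (P? s) (λ ¬Ps → ∄¬P (s , ¬Ps)))
                     (λ ∀P (s , ¬Ps) → ¬Ps (∀P s))
                     (¬? (anySubset? (¬? ∘ P?)))

module _ {n r ℓ} {P : Pred (Vertex n r) ℓ} (P? : U.Decidable P) where

  private
    OnVertex : Pred (Subset n) ℓ
    OnVertex s = (p : ∣ s ∣ ≡ r) → P (s , p)

    onVertex? : U.Decidable OnVertex
    onVertex? s with ∣ s ∣ ≟ r
    ... | no  ∣s∣≢r = yes (λ p → contradiction p ∣s∣≢r)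
    ... | yes p     = map′ (λ Ps q → subst (P ∘ (s ,_)) (≡-irrelevant p q) Ps) (λ f → f p) (P? (s , p))

  allVertices? : Dec (∀ v → P v)
  allVertices? = map′ (λ f (s , p) → f s p) (λ g s p → g (s , p)) (allSubsets? onVertex?)

isKTupleDominating? : ∀ {n r} k (D : List (Vertex n r)) → Dec (IsKTupleDominating k D)
isKTupleDominating? {n} k D = unique? (_≟S_ {n}) (map proj₁ D) ×-dec allVertices? (λ v → k ≤? nbhdCount D v)

module _ {n r : ℕ} where

  inClosedNbhd-sym : {u v : Vertex n r} → InClosedNbhd u v → InClosedNbhd v u
  inClosedNbhd-sym (inj₁ u≡v)                   = inj₁ (sym u≡v)
  inClosedNbhd-sym {u , _} {v , _} (inj₂ u∩v≡⊥) = inj₂ (trans (∩-comm v u) u∩v≡⊥)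

  nbhdCount-flip : ∀ (A : List (Vertex n r)) u → length (filter (inClosedNbhd? u) A) ≡ nbhdCount A u
  nbhdCount-flip A u =
    cong length (filter-≐ (inClosedNbhd? u) (λ v → inClosedNbhd? v u) ((λ {v} → inClosedNbhd-sym {u = u} {v}) , (λ {v} → inClosedNbhd-sym {u = v} {u})) A)

  kTupleDominating-length : ∀ {k d} (A D : List (Vertex n r)) →
    (∀ u → nbhdCount A u ≤ d) → IsKTupleDominating k D → length A * k ≤ d * length D
  kTupleDominating-length {k} {d} A D A-sparse (_ , D-dom) = begin
    length A * k                                          ≡⟨ sum-map-const k A ⟨
    sum (map (λ _ → k) A)                                 ≤⟨ sum-map-mono D-dom A ⟩
    sum (map (nbhdCount D) A)                             ≡⟨ sum-count-swap inClosedNbhd? D A ⟩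
    sum (map (λ u → length (filter (inClosedNbhd? u) A)) D) ≡⟨ cong sum (map-cong (nbhdCount-flip A) D) ⟩
    sum (map (nbhdCount A) D)                             ≤⟨ sum-map-mono A-sparse D ⟩
    sum (map (λ _ → d) D)                                 ≡⟨ sum-map-const d D ⟩
    length D * d                                          ≡⟨ *-comm (length D) d ⟩
    d * length D                                          ∎
    where open ≤-Reasoning

subsets : ∀ n → List (Subset n)
subsets zero    = [ Vec.[] ]
subsets (suc n) = map (inside Vec.∷_) (subsets n) ++ map (outside Vec.∷_) (subsets n)

toVertex : ∀ {n} r → Subset n → Maybe (Vertex n r)
toVertex r s with ∣ s ∣ ≟ r
... | yes p = just (s , p)
... | no  _ = nothing

vertices : ∀ n r → List (Vertex n r)
vertices n r = mapMaybe (toVertex r) (subsets n)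

verticesOutside : ∀ {n r} → List (Vertex n r) → List (Vertex n r)
verticesOutside {n} {r} D = filter (λ v → proj₁ v ∉? map proj₁ D) (vertices n r)
  where open import Data.List.Membership.DecPropositional (_≟S_ {n}) using (_∉?_)

development : ∀ n .{{_ : NonZero n}} r → List ℕ → List (Vertex n r)
development n r B = mapMaybe (toVertex r) (map translate (upTo n))
  where
  translate : ℕ → Subset n
  translate i = foldr (λ b s → ⁅ (i + b) mod n ⁆ ∪ s) ⊥ B

fanoLines bothFanoLines : List (Vertex 7 3)
fanoLines     = development 7 3 (0 ∷ 1 ∷ 3 ∷ [])
bothFanoLines = fanoLines ++ development 7 3 (0 ∷ 2 ∷ 3 ∷ [])

closedNbhd-size : ∀ u → nbhdCount (vertices 7 3) u ≡ 5
closedNbhd-size = from-yes (allVertices? (λ u → nbhdCount (vertices 7 3) u ≟ 5))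

mainTheorem3 : (k : ℕ) → 1 ≤ k → k ≤ 5 → KTupleDominationNumberIs 7 3 k (7 * k)
mainTheorem3 k 1≤k k≤5 = upper k 1≤k k≤5 , lower
  where
  DominatingOfSize : ℕ → Set
  DominatingOfSize k = Σ (List (Vertex 7 3)) (λ D → IsKTupleDominating k D × length D ≡ 7 * k)

  upper : ∀ k → 1 ≤ k → k ≤ 5 → DominatingOfSize k
  upper 1 _ _ = fanoLines                     , from-yes (isKTupleDominating? 1 fanoLines) , refl
  upper 2 _ _ = bothFanoLines                 , from-yes (isKTupleDominating? 2 bothFanoLines) , refl
  upper 3 _ _ = verticesOutside bothFanoLines , from-yes (isKTupleDominating? 3 (verticesOutside bothFanoLines)) , refl
  upper 4 _ _ = verticesOutside fanoLines     , from-yes (isKTupleDominating? 4 (verticesOutside fanoLines)) , refl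
  upper 5 _ _ = vertices 7 3                  , from-yes (isKTupleDominating? 5 (vertices 7 3)) , refl
  upper (suc (suc (suc (suc (suc (suc _)))))) _ (s≤s (s≤s (s≤s (s≤s (s≤s ())))))

  lower : ∀ D → IsKTupleDominating k D → length D ≥ 7 * k
  lower D D-dom = *-cancelˡ-≤ 5 (begin
    5 * (7 * k)               ≡⟨ *-assoc 5 7 k ⟨
    length (vertices 7 3) * k ≤⟨ kTupleDominating-length (vertices 7 3) D (≤-reflexive ∘ closedNbhd-size) D-dom ⟩
    5 * length D              ∎)
    where open ≤-Reasoning
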